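{- Let $w$ be a word equation that has a solved form $\mathcal{S}$, and let $\mathcal{R}$ be the set of length constraints derived from $\mathcal{S}$. Then $w$ is equisatisfiable with (the conjunction of) $\mathcal{R}$.
   Context: Fix a finite alphabet $\Sigma$. A word equation is $t_1=t_2$, where $t_1,t_2$ are concatenations of string variables and constants from $\Sigma^*$; variables range over $\Sigma^*$. Unfixed parts are fresh symbols standing for arbitrary words, replaced consistently across occurrences. An integer parameter $i$ ranges over $\mathbb{N}$, and $u^{i}$ denotes the $i$-fold concatenation of $u$. A solved form of $w$ is a finite set $\mathcal{S}$ of equations that is logically equivalent to $w$ and satisfies two conditions: - Each element of $\mathcal{S}$ has the form $X=t$, where $X$ is a variable of $w$, and $t$ is a finite concatenation of constants occurring in $w$, possibly raised to integer parameters occurring linearly as $ci$, and of unfixed parts. - Each variable of $w$ occurs exactly once as a left-hand side and never on a right-hand side. The derived set $\mathcal{R}$ is defined as follows. Consider each equation $X = t_1\cdots t_n$ in $\mathcal{S}$, and let $C$ be the total length of the constants $t_j$ that carry no integer parameter. For each parameterized constant, with integer parameter $i_r$, let $c_r$ be its length. Let $y_1,\dots,y_p$ be the unfixed parts occurring in the equation. The equation contributes $$\mathrm{len}(X) = C + \sum_r c_r i_r + \sum_s \mathrm{len}(y_s),$$ together with the constraints $i_r\ge 0$ and $\mathrm{len}(y_s)\ge 0$. Here the integer parameters and the lengths of the unfixed parts are treated as integer variables. The set $\mathcal{R}$ is the union of these constraints over all equations of $\mathcal{S}$. Two formulas are equisatisfiable if one is satisfiable if and only if the other is. -}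

module Defs where

open import Data.Nat as ℕ using (ℕ; _≟_)
open import Data.Empty using (⊥)
open import Relation.Nullary using (yes; no)
open import Data.Fin using (Fin)
open import Data.List using (List; []; _∷_; _++_; concat; map; length; filter)
open import Data.List.Membership.Propositional using (_∈_)
open import Data.Product using (Σ; _×_; _,_; proj₁; proj₂; ∃)
open import Data.Integer as ℤ using (ℤ; +_; _≤_)
open import Relation.Binary.PropositionalEquality using (_≡_)
open import Relation.Nullary using (¬_)
open import Relation.Unary using (Pred)
open import Level using (0ℓ)

Word : ℕ → Set
Word k = List (Fin k)

_^^_ : ∀ {k} → Word k → ℕ → Word k
u ^^ ℕ.zero  = []
u ^^ ℕ.suc i = u ++ (u ^^ i)

data Sym (k : ℕ) : Set where
  var : ℕ → Sym k
  con : Word k → Sym k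

Term : ℕ → Set
Term k = List (Sym k)

record WordEq (k : ℕ) : Set where
  constructor _≐_
  field
    lhs : Term k
    rhs : Term k
open WordEq public

Assignment : ℕ → Set
Assignment k = ℕ → Word k

evalSym : ∀ {k} → Assignment k → Sym k → Word k
evalSym σ (var x) = σ x
evalSym σ (con u) = u

evalTerm : ∀ {k} → Assignment k → Term k → Word k
evalTerm σ t = concat (map (evalSym σ) t)

_⊨_ : ∀ {k} → Assignment k → WordEq k → Set
σ ⊨ w = evalTerm σ (lhs w) ≡ evalTerm σ (rhs w)

WSat : ∀ {k} → WordEq k → Set
WSat {k} w = Σ (Assignment k) λ σ → σ ⊨ w

IsVarOf : ∀ {k} → ℕ → WordEq k → Set
IsVarOf x w = var x ∈ (lhs w ++ rhs w)

LetterOf : ∀ {k} → Fin k → WordEq k → Set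
LetterOf a w = Σ _ λ u → con u ∈ (lhs w ++ rhs w) × a ∈ u

data Item (k : ℕ) : Set where
  const   : Word k → Item k
  pow     : Word k → ℕ → Item k      -- constant u raised to integer parameter i_r (named r)
  unfixed : ℕ → Item k               -- unfixed part y_s (named s)

SolvedEq : ℕ → Set
SolvedEq k = ℕ × List (Item k)

evalItem : ∀ {k} → (ℕ → ℕ) → (ℕ → Word k) → Item k → Word k
evalItem p y (const u)   = u
evalItem p y (pow u r)   = u ^^ p r
evalItem p y (unfixed s) = y s

evalItems : ∀ {k} → (ℕ → ℕ) → (ℕ → Word k) → List (Item k) → Word k
evalItems p y t = concat (map (evalItem p y) t)

InstanceOf : ∀ {k} → Assignment k → List (SolvedEq k) → Set
InstanceOf {k} σ S =
  Σ (ℕ → ℕ) λ p → Σ (ℕ → Word k) λ y →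
    ∀ {X t} → (X , t) ∈ S → σ X ≡ evalItems p y t

ItemConst : ∀ {k} → Word k → Item k → Set
ItemConst u (const v)   = u ≡ v
ItemConst u (pow v _)   = u ≡ v
ItemConst u (unfixed _) = ⊥

lhsCount : ∀ {k} → ℕ → List (SolvedEq k) → ℕ
lhsCount X []             = 0
lhsCount X ((Y , _) ∷ S) with X ≟ Y
... | yes _ = ℕ.suc (lhsCount X S)
... | no  _ = lhsCount X S

record IsSolvedForm {k : ℕ} (w : WordEq k) (S : List (SolvedEq k)) : Set where
  field
    lhs-var    : ∀ {X t} → (X , t) ∈ S → IsVarOf X w
    -- each variable of w occurs exactly once as a left-hand side
    -- (variables never occur on right-hand sides by construction of Item)
    lhs-once   : ∀ X → IsVarOf X w → lhsCount X S ≡ 1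
    consts-ofw : ∀ {X t it u a} → (X , t) ∈ S → it ∈ t → ItemConst u it → a ∈ u → LetterOf a w
    equiv      : ∀ (σ : Assignment k) → (σ ⊨ w → InstanceOf σ S) × (InstanceOf σ S → σ ⊨ w)

data IVar : Set where
  lenVar : ℕ → IVar
  param  : ℕ → IVar
  lenUnf : ℕ → IVar

data Constraint : Set where
  linEq : IVar → ℤ → List (ℤ × IVar) → Constraint
  nonneg : IVar → Constraint

constLen : ∀ {k} → List (Item k) → ℕ
constLen []                  = 0
constLen (const u ∷ t)       = length u ℕ.+ constLen t
constLen (pow _ _ ∷ t)       = constLen t
constLen (unfixed _ ∷ t)     = constLen t

linTerms : ∀ {k} → List (Item k) → List (ℤ × IVar)
linTerms []                = []
linTerms (const _ ∷ t)     = linTerms t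
linTerms (pow u r ∷ t)     = (+ length u , param r) ∷ linTerms t
linTerms (unfixed s ∷ t)   = (+ 1 , lenUnf s) ∷ linTerms t

nonnegs : ∀ {k} → List (Item k) → List Constraint
nonnegs []              = []
nonnegs (const _ ∷ t)   = nonnegs t
nonnegs (pow _ r ∷ t)   = nonneg (param r) ∷ nonnegs t
nonnegs (unfixed s ∷ t) = nonneg (lenUnf s) ∷ nonnegs t

constraintsOf : ∀ {k} → SolvedEq k → List Constraint
constraintsOf (X , t) = linEq (lenVar X) (+ constLen t) (linTerms t) ∷ nonnegs t

derived : ∀ {k} → List (SolvedEq k) → List Constraint
derived S = concat (map constraintsOf S)

IAssignment : Set
IAssignment = IVar → ℤ

linSum : IAssignment → List (ℤ × IVar) → ℤ
linSum ν []             = + 0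
linSum ν ((a , v) ∷ ts) = a ℤ.* ν v ℤ.+ linSum ν ts

_⊨ᶜ_ : IAssignment → Constraint → Set
ν ⊨ᶜ linEq x c ts = ν x ≡ c ℤ.+ linSum ν ts
ν ⊨ᶜ nonneg v     = + 0 ≤ ν v

RSat : List Constraint → Set
RSat R = Σ IAssignment λ ν → ∀ {φ} → φ ∈ R → ν ⊨ᶜ φ

Equisat : Set → Set → Set
Equisat P Q = (P → Q) × (Q → P)

-- A solution of w is an instance of S, and the lengths of its words, parameters and unfixed
-- parts satisfy R, since the length of X = t₁⋯tₙ is additive in the tᵢ and
-- len(u^i) = len(u)·i. Conversely both sides are always satisfiable: setting every parameter
-- to 0 and every unfixed part to ε, each X is determined by its unique equation in S, and
-- the resulting assignment solves w because S is equivalent to w.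
module Submission where

open import Defs
open import Data.Nat as ℕ using (ℕ; zero; suc; _≟_; z≤n)
open import Data.Nat.Properties as ℕ using (suc-injective)
open import Data.List using (List; []; _∷_; _++_; length)
open import Data.List.Properties using (length-++)
open import Data.List.Membership.Propositional using (_∈_)
open import Data.List.Membership.Propositional.Properties using (∈-++⁻)
open import Data.List.Relation.Unary.Any using (here; there)
open import Data.Product using (Σ; _,_; proj₁; proj₂)
open import Data.Sum using (inj₁; inj₂)
open import Data.Empty using (⊥-elim)
open import Relation.Nullary using (yes; no)
open import Data.Integer as ℤ using (+_; +≤+)
open import Data.Integer.Properties as ℤ using (pos-+; pos-*)
open import Algebra.Properties.CommutativeSemigroup ℤ.+-commutativeSemigroup using (x∙yz≈y∙xz)
open import Relation.Binary.PropositionalEquality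
open import Function using (_∘_)

length-^^ : ∀ {k} (u : Word k) n → length (u ^^ n) ≡ length u ℕ.* n
length-^^ u zero    = sym (ℕ.*-zeroʳ (length u))
length-^^ u (suc n) = begin
  length (u ++ u ^^ n)            ≡⟨ length-++ u ⟩
  length u ℕ.+ length (u ^^ n)    ≡⟨ cong (length u ℕ.+_) (length-^^ u n) ⟩
  length u ℕ.+ length u ℕ.* n     ≡⟨ ℕ.*-suc (length u) n ⟨
  length u ℕ.* suc n              ∎
  where open ≡-Reasoning

module _ {k : ℕ} (p : ℕ → ℕ) (y : ℕ → Word k) where

  instanceLengths : Assignment k → IAssignment
  instanceLengths σ (lenVar X) = + length (σ X)
  instanceLengths σ (param r)  = + p r
  instanceLengths σ (lenUnf s) = + length (y s)

  length-evalItems : ∀ σ (t : List (Item k)) →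
    + length (evalItems p y t) ≡ + constLen t ℤ.+ linSum (instanceLengths σ) (linTerms t)
  length-evalItems σ [] = refl
  length-evalItems σ (const u ∷ t) = begin
    + length (u ++ evalItems p y t)                    ≡⟨ cong +_ (length-++ u) ⟩
    + (length u ℕ.+ length (evalItems p y t))         ≡⟨ pos-+ (length u) _ ⟩
    + length u ℤ.+ + length (evalItems p y t)         ≡⟨ cong (ℤ._+_ (+ length u)) (length-evalItems σ t) ⟩
    + length u ℤ.+ (+ constLen t ℤ.+ L)               ≡⟨ ℤ.+-assoc (+ length u) (+ constLen t) L ⟨
    + length u ℤ.+ + constLen t ℤ.+ L                 ≡⟨ cong (ℤ._+ L) (pos-+ (length u) (constLen t)) ⟨
    + (length u ℕ.+ constLen t) ℤ.+ L                 ∎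
    where open ≡-Reasoning
          L = linSum (instanceLengths σ) (linTerms t)
  length-evalItems σ (pow u r ∷ t) = begin
    + length (u ^^ p r ++ evalItems p y t)                      ≡⟨ cong +_ (length-++ (u ^^ p r)) ⟩
    + (length (u ^^ p r) ℕ.+ length (evalItems p y t))         ≡⟨ pos-+ (length (u ^^ p r)) _ ⟩
    + length (u ^^ p r) ℤ.+ + length (evalItems p y t)         ≡⟨ cong₂ ℤ._+_ powLength (length-evalItems σ t) ⟩
    + length u ℤ.* + p r ℤ.+ (+ constLen t ℤ.+ L)              ≡⟨ x∙yz≈y∙xz (+ length u ℤ.* + p r) (+ constLen t) L ⟩
    + constLen t ℤ.+ (+ length u ℤ.* + p r ℤ.+ L)              ∎
    where open ≡-Reasoning
          L = linSum (instanceLengths σ) (linTerms t)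
          powLength : + length (u ^^ p r) ≡ + length u ℤ.* + p r
          powLength = trans (cong +_ (length-^^ u (p r))) (pos-* (length u) (p r))
  length-evalItems σ (unfixed s ∷ t) = begin
    + length (y s ++ evalItems p y t)                  ≡⟨ cong +_ (length-++ (y s)) ⟩
    + (length (y s) ℕ.+ length (evalItems p y t))     ≡⟨ pos-+ (length (y s)) _ ⟩
    + length (y s) ℤ.+ + length (evalItems p y t)     ≡⟨ cong₂ ℤ._+_ (sym (ℤ.*-identityˡ (+ length (y s)))) (length-evalItems σ t) ⟩
    + 1 ℤ.* + length (y s) ℤ.+ (+ constLen t ℤ.+ L)   ≡⟨ x∙yz≈y∙xz (+ 1 ℤ.* + length (y s)) (+ constLen t) L ⟩
    + constLen t ℤ.+ (+ 1 ℤ.* + length (y s) ℤ.+ L)   ∎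
    where open ≡-Reasoning
          L = linSum (instanceLengths σ) (linTerms t)

nonnegs-sat : ∀ {k} {ν : IAssignment} (t : List (Item k)) →
  (∀ v → + 0 ℤ.≤ ν v) → ∀ {φ} → φ ∈ nonnegs t → ν ⊨ᶜ φ
nonnegs-sat (const _ ∷ t)   ν≥0 φ∈        = nonnegs-sat t ν≥0 φ∈
nonnegs-sat (pow _ r ∷ t)   ν≥0 (here refl) = ν≥0 (param r)
nonnegs-sat (pow _ _ ∷ t)   ν≥0 (there φ∈)  = nonnegs-sat t ν≥0 φ∈
nonnegs-sat (unfixed s ∷ t) ν≥0 (here refl) = ν≥0 (lenUnf s)
nonnegs-sat (unfixed _ ∷ t) ν≥0 (there φ∈)  = nonnegs-sat t ν≥0 φ∈

instance-lengths-sat : ∀ {k} {σ : Assignment k} {p y} (S : List (SolvedEq k)) →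
  (∀ {X t} → (X , t) ∈ S → σ X ≡ evalItems p y t) →
  ∀ {φ} → φ ∈ derived S → instanceLengths p y σ ⊨ᶜ φ
instance-lengths-sat {σ = σ} {p} {y} ((X , t) ∷ S) inst φ∈ with ∈-++⁻ (constraintsOf (X , t)) φ∈
... | inj₁ (here refl) = trans (cong (λ u → + length u) (inst (here refl))) (length-evalItems p y σ t)
... | inj₁ (there φ∈t) = nonnegs-sat t lengths≥0 φ∈t
  where
  lengths≥0 : ∀ v → + 0 ℤ.≤ instanceLengths p y σ v
  lengths≥0 (lenVar _) = +≤+ z≤n
  lengths≥0 (param _)  = +≤+ z≤n
  lengths≥0 (lenUnf _) = +≤+ z≤n
... | inj₂ φ∈S = instance-lengths-sat S (inst ∘ there) φ∈S

rhsOf : ∀ {k} → ℕ → List (SolvedEq k) → List (Item k)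
rhsOf X []            = []
rhsOf X ((Y , t) ∷ S) with X ≟ Y
... | yes _ = t
... | no  _ = rhsOf X S

lhsCount-∈ : ∀ {k} {X t} (S : List (SolvedEq k)) → (X , t) ∈ S → lhsCount X S ≢ 0
lhsCount-∈ {X = X} ((Y , _) ∷ S) X,t∈ with X ≟ Y | X,t∈
... | yes _ | _           = λ ()
... | no X≢Y | here refl  = ⊥-elim (X≢Y refl)
... | no _   | there X,t∈S = lhsCount-∈ S X,t∈S

rhsOf-unique : ∀ {k} {X t} (S : List (SolvedEq k)) →
  (X , t) ∈ S → lhsCount X S ≡ 1 → rhsOf X S ≡ t
rhsOf-unique {X = X} ((Y , _) ∷ S) X,t∈ once with X ≟ Y | X,t∈
... | yes _  | here refl   = refl
... | yes _  | there X,t∈S = ⊥-elim (lhsCount-∈ S X,t∈S (suc-injective once))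
... | no X≢Y | here refl   = ⊥-elim (X≢Y refl)
... | no _   | there X,t∈S = rhsOf-unique S X,t∈S once

solvedForm-instance : ∀ {k} {w : WordEq k} {S} → IsSolvedForm w S → Σ (Assignment k) λ σ → InstanceOf σ S
solvedForm-instance {S = S} sf =
  (λ X → evalItems p y (rhsOf X S)) , p , y ,
  λ {X} X,t∈ → cong (evalItems p y) (rhsOf-unique S X,t∈ (lhs-once X (lhs-var X,t∈)))
  where
  open IsSolvedForm sf
  p : ℕ → ℕ
  p _ = 0
  y : ℕ → Word _
  y _ = []

lemma2 : (k : ℕ) (w : WordEq k) (S : List (SolvedEq k)) →
           IsSolvedForm w S →
           Equisat (WSat w) (RSat (derived S))
lemma2 k w S sf = solution⇒lengths , λ _ → solution
  where
  open IsSolvedForm sf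
  solution⇒lengths : WSat w → RSat (derived S)
  solution⇒lengths (σ , σ⊨w) with proj₁ (equiv σ) σ⊨w
  ... | p , y , inst = instanceLengths p y σ , instance-lengths-sat S inst
  solution : WSat w
  solution with solvedForm-instance sf
  ... | σ , σ-instance = σ , proj₂ (equiv σ) σ-instance
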